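{- Let $n\ge1$ and let $P\in\{0,1\}^{n\times n}$ be nonsingular such that the simplex $\mathrm{conv}\{0,p_1,\dots,p_n\}$, where $p_1,\dots,p_n$ are the columns of $P$, is acute. Then $P$ is fully indecomposable and has a doubly stochastic pattern.
   Context: A simplex is acute if all its dihedral angles (the angle $\pi$ minus the angle between the inward normals of two facets) are less than $\pi/2$. A nonnegative matrix $A$ has a doubly stochastic pattern if there exists a doubly stochastic matrix $D$ with $\mathrm{supp}(D)=\mathrm{supp}(A)$, where $\mathrm{supp}(X)$ is the set of index pairs $(i,j)$ with $x_{ij}\neq 0$. A matrix $A\in\{0,1\}^{n\times n}$ is partly decomposable if there exist $k\in\{1,\dots,n-1\}$ and permutation matrices $\Pi_1,\Pi_2$ such that $\Pi_1^\top A\Pi_2=\begin{bmatrix}A_{11}&A_{12}\\0&A_{22}\end{bmatrix}$ with $A_{11}$ of size $k\times k$ and $A_{22}$ of size $(n-k)\times(n-k)$; otherwise $A$ is fully indecomposable. -}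

module Defs where

open import Data.Nat using (ℕ; zero; suc; _≤_; _<_; _∸_)
open import Data.Fin using (Fin; zero; suc; toℕ)
open import Data.Bool using (Bool; true; false)
open import Data.Rational using (ℚ; 0ℚ; 1ℚ; _+_; _*_; _-_)
  renaming (_<_ to _<ℚ_; _≤_ to _≤ℚ_; -_ to -ℚ_)
open import Data.Product using (Σ; _×_; ∃; ∃-syntax)
open import Data.Fin.Permutation using (Permutation′; _⟨$⟩ʳ_)
open import Relation.Binary.PropositionalEquality using (_≡_; _≢_)
open import Relation.Nullary using (¬_)
open import Function.Bundles using (_⇔_)

-- Real-valued vectors / matrices are modelled over ℚ.
Vecℚ : ℕ → Set
Vecℚ n = Fin n → ℚ

Matℚ : ℕ → Set
Matℚ n = Fin n → Fin n → ℚ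

Mat01 : ℕ → Set
Mat01 n = Fin n → Fin n → Bool

b2q : Bool → ℚ
b2q true  = 1ℚ
b2q false = 0ℚ

toℚMat : ∀ {n} → Mat01 n → Matℚ n
toℚMat P i j = b2q (P i j)

sumFin : ∀ n → (Fin n → ℚ) → ℚ
sumFin zero    f = 0ℚ
sumFin (suc n) f = f zero + sumFin n (λ i → f (suc i))

dot : ∀ {n} → Vecℚ n → Vecℚ n → ℚ
dot {n} u v = sumFin n (λ i → u i * v i)

δ : ∀ {n} → Fin n → Fin n → ℚ
δ zero    zero    = 1ℚ
δ zero    (suc _) = 0ℚ
δ (suc _) zero    = 0ℚ
δ (suc i) (suc j) = δ i j

Nonsingular : ∀ {n} → Matℚ n → Set
Nonsingular {n} A =
  Σ (Matℚ n) λ Q → (∀ i j → sumFin n (λ k → Q i k * A k j) ≡ δ i j)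
                 × (∀ i j → sumFin n (λ k → A i k * Q k j) ≡ δ i j)

col : ∀ {n} → Matℚ n → Fin n → Vecℚ n
col A j i = A i j

vertex : ∀ {n} → Matℚ n → Fin (suc n) → Vecℚ n
vertex A zero    = λ _ → 0ℚ
vertex A (suc j) = col A j

_-ᵥ_ : ∀ {n} → Vecℚ n → Vecℚ n → Vecℚ n
(u -ᵥ v) i = u i - v i

-- Facets are indexed by the opposite vertex k.  u is an inward normal of the facet
-- opposite vertex k: u is orthogonal to the facet (all edges inside the facet) and
-- points from the facet towards the opposite vertex k.
InwardNormal : ∀ {n} → Matℚ n → Fin (suc n) → Vecℚ n → Set
InwardNormal A k u =
  (∀ a b → a ≢ k → b ≢ k → dot u (vertex A a -ᵥ vertex A b) ≡ 0ℚ)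
  × (∀ a → a ≢ k → 0ℚ <ℚ dot u (vertex A k -ᵥ vertex A a))

-- Acute: every dihedral angle  π − ∠(u,v)  is < π/2, i.e. the angle between
-- the inward normals u,v of two distinct facets exceeds π/2, i.e. ⟨u,v⟩ < 0.
AcuteSimplex : ∀ {n} → Matℚ n → Set
AcuteSimplex {n} A =
  ∀ k l → k ≢ l → ∀ (u v : Vecℚ n) →
    InwardNormal A k u → InwardNormal A l v → dot u v <ℚ 0ℚ

supp-eq : ∀ {n} → Matℚ n → Mat01 n → Set
supp-eq D P = ∀ i j → (D i j ≢ 0ℚ) ⇔ (P i j ≡ true)

DoublyStochastic : ∀ {n} → Matℚ n → Set
DoublyStochastic {n} D =
  (∀ i j → 0ℚ ≤ℚ D i j)
  × (∀ i → sumFin n (λ j → D i j) ≡ 1ℚ)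
  × (∀ j → sumFin n (λ i → D i j) ≡ 1ℚ)

HasDoublyStochasticPattern : ∀ {n} → Mat01 n → Set
HasDoublyStochasticPattern {n} P =
  ∃[ D ] (DoublyStochastic D × supp-eq D P)

-- partly decomposable: (Π₁ᵀ P Π₂)_{ab} = P_{σ a, τ b}; the lower-left block
-- (rows a ≥ k, columns b < k, 0-indexed) is zero, with 1 ≤ k ≤ n-1.
PartlyDecomposable : ∀ {n} → Mat01 n → Set
PartlyDecomposable {n} P =
  ∃[ k ] (1 ≤ k × k ≤ n ∸ 1 ×
    Σ (Permutation′ n) λ σ → Σ (Permutation′ n) λ τ →
      (∀ (a b : Fin n) → k ≤ toℕ a → toℕ b < k → P (σ ⟨$⟩ʳ a) (τ ⟨$⟩ʳ b) ≡ false))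

FullyIndecomposable : ∀ {n} → Mat01 n → Set
FullyIndecomposable P = ¬ PartlyDecomposable P

-- Let Q = P⁻¹.  The facet of conv{0, p₁, …, pₙ} opposite pₖ has the k-th row
-- of Q as inward normal, and the facet opposite 0 has  u₀ = −Σₘ Qₘ.
-- Acuteness therefore says that the Gram matrix G = Q Qᵀ has negative
-- off-diagonal entries and positive row sums.  Writing  Qᵀ = G Pᵀ  we get
--   Q j i > 0  when P i j = 1        (Q-pos),
--   Q j i < 0  when P i j = 0 but row i of P is not zero   (Q-neg).
-- Hence the Hadamard product E = P ∘ Qᵀ is doubly stochastic (rows and
-- columns of P Q = Q P = I) with support exactly supp P.
-- For full indecomposability: a doubly stochastic matrix with a zero
-- off-diagonal block has the complementary block zero too, so a partly
-- decomposable P would be a direct sum and would have two columns with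
-- disjoint supports; by Q-neg that contradicts  (Q P) j l = 0.
-- The file develops sums over Fin, dot products, doubly stochastic matrices,
-- the normals of the simplex of an invertible matrix, and finally the 0/1 case.
module Submission where

open import Defs
open import Data.Nat using (ℕ; zero; suc; _≤_; _<_; _∸_; _<?_; s≤s)
import Data.Nat.Properties as NP
open import Data.Product using (_×_; _,_)
open import Data.Fin using (Fin; zero; suc; toℕ; fromℕ<)
open import Data.Fin.Properties using (toℕ-fromℕ<; suc-injective)
open import Data.Fin.Permutation using (Permutation′; _⟨$⟩ʳ_; _⟨$⟩ˡ_; inverseˡ; inverseʳ)
open import Data.Bool using (true; false)
open import Data.Bool.Properties using (¬-not)
open import Relation.Nullary using (¬_; Dec; yes; no; contradiction)
open import Relation.Unary using (Pred; Decidable)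
open import Relation.Binary.PropositionalEquality
open import Function.Bundles using (mk⇔)
open import Data.Rational using (ℚ; 0ℚ; 1ℚ; _+_; _*_; _-_; -_)
  renaming (_<_ to _<ℚ_; _≤_ to _≤ℚ_)
open import Data.Rational.Properties
  using ( *-comm; *-identityˡ; *-identityʳ; *-zeroˡ; *-zeroʳ; +-identityˡ; +-identityʳ
        ; +-inverseʳ; neg-distrib-+; neg-distribˡ-*; +-*-ring
        ; ≤-refl; ≤-reflexive; ≤-trans; ≤-antisym; <⇒≤; <⇒≢; <-irrefl; ≮⇒≥
        ; <-≤-trans; +-mono-≤; +-mono-<-≤; +-mono-≤-<; neg-antimono-<
        ; positive⁻¹ )
open import Data.Rational.Solver using (module +-*-Solver)
open +-*-Solver using (solve; _:+_; _:*_; :-_; _:=_)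
open import Algebra.Bundles using (Ring)
import Algebra.Properties.Semiring.Sum as SemiringSum

private
  variable
    n : ℕ

below-pred : ∀ {k} n → 1 ≤ k → k ≤ n ∸ 1 → k < n
below-pred zero    1≤k k≤0 = contradiction (NP.≤-trans 1≤k k≤0) (λ ())
below-pred (suc n) _   k≤n = s≤s k≤n

module ∑ = SemiringSum (Ring.semiring +-*-ring)

sumFin≡∑ : ∀ n (f : Fin n → ℚ) → sumFin n f ≡ ∑.sum f
sumFin≡∑ zero    f = refl
sumFin≡∑ (suc n) f = cong (f zero +_) (sumFin≡∑ n (λ i → f (suc i)))

sum-cong : ∀ n {f g : Fin n → ℚ} → (∀ i → f i ≡ g i) → sumFin n f ≡ sumFin n g
sum-cong n {f} {g} f≗g =
  trans (sumFin≡∑ n f) (trans (∑.sum-cong-≗ f≗g) (sym (sumFin≡∑ n g)))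

sum-zero : ∀ n → sumFin n (λ _ → 0ℚ) ≡ 0ℚ
sum-zero n = trans (sumFin≡∑ n _) (∑.sum-replicate-zero n)

sum-+ : ∀ n (f g : Fin n → ℚ) →
        sumFin n (λ i → f i + g i) ≡ sumFin n f + sumFin n g
sum-+ n f g = trans (sumFin≡∑ n _)
  (trans (∑.∑-distrib-+ f g) (sym (cong₂ _+_ (sumFin≡∑ n f) (sumFin≡∑ n g))))

sum-*ˡ : ∀ n c (f : Fin n → ℚ) → c * sumFin n f ≡ sumFin n (λ i → c * f i)
sum-*ˡ n c f = trans (cong (c *_) (sumFin≡∑ n f))
  (trans (∑.*-distribˡ-sum c f) (sym (sumFin≡∑ n _)))

sum-*ʳ : ∀ n c (f : Fin n → ℚ) → sumFin n f * c ≡ sumFin n (λ i → f i * c)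
sum-*ʳ n c f = trans (cong (_* c) (sumFin≡∑ n f))
  (trans (∑.*-distribʳ-sum c f) (sym (sumFin≡∑ n _)))

sumFin²≡∑² : ∀ m n (f : Fin m → Fin n → ℚ) →
  sumFin m (λ i → sumFin n (f i)) ≡ ∑.sum (λ i → ∑.sum (f i))
sumFin²≡∑² m n f =
  trans (sumFin≡∑ m _) (∑.sum-cong-≗ (λ i → sumFin≡∑ n (f i)))

sum-swap : ∀ m n (f : Fin m → Fin n → ℚ) →
  sumFin m (λ i → sumFin n (f i)) ≡ sumFin n (λ j → sumFin m (λ i → f i j))
sum-swap m n f = trans (sumFin²≡∑² m n f)
  (trans (∑.∑-comm f) (sym (sumFin²≡∑² n m (λ j i → f i j))))

sum-permute : ∀ n (f : Fin n → ℚ) (π : Permutation′ n) →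
              sumFin n f ≡ sumFin n (λ i → f (π ⟨$⟩ʳ i))
sum-permute n f π = trans (sumFin≡∑ n f)
  (trans (∑.∑-permute f π) (sym (sumFin≡∑ n _)))

sum-neg : ∀ n (f : Fin n → ℚ) → - sumFin n f ≡ sumFin n (λ i → - f i)
sum-neg zero    f = refl
sum-neg (suc n) f =
  trans (neg-distrib-+ (f zero) _) (cong (- f zero +_) (sum-neg n (λ i → f (suc i))))

sum-mono-≤ : ∀ n {f g : Fin n → ℚ} → (∀ i → f i ≤ℚ g i) → sumFin n f ≤ℚ sumFin n g
sum-mono-≤ zero    f≤g = ≤-refl
sum-mono-≤ (suc n) f≤g = +-mono-≤ (f≤g zero) (sum-mono-≤ n (λ i → f≤g (suc i)))

sum-mono-< : ∀ n {f g : Fin n → ℚ} → (∀ i → f i ≤ℚ g i) →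
             ∀ i₀ → f i₀ <ℚ g i₀ → sumFin n f <ℚ sumFin n g
sum-mono-< (suc n) f≤g zero     f<g = +-mono-<-≤ f<g (sum-mono-≤ n (λ i → f≤g (suc i)))
sum-mono-< (suc n) f≤g (suc i₀) f<g =
  +-mono-≤-< (f≤g zero) (sum-mono-< n (λ i → f≤g (suc i)) i₀ f<g)

sum-<0 : ∀ n {f : Fin n → ℚ} → (∀ i → f i ≤ℚ 0ℚ) → ∀ i₀ → f i₀ <ℚ 0ℚ →
         sumFin n f <ℚ 0ℚ
sum-<0 n {f} f≤0 i₀ f<0 = subst (sumFin n f <ℚ_) (sum-zero n) (sum-mono-< n f≤0 i₀ f<0)

δ-diag : (i : Fin n) → δ i i ≡ 1ℚ
δ-diag zero    = refl
δ-diag (suc i) = δ-diag i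

δ-≢ : (i j : Fin n) → i ≢ j → δ i j ≡ 0ℚ
δ-≢ zero    zero    i≢j = contradiction refl i≢j
δ-≢ zero    (suc j) i≢j = refl
δ-≢ (suc i) zero    i≢j = refl
δ-≢ (suc i) (suc j) i≢j = δ-≢ i j (λ i≡j → i≢j (cong suc i≡j))

δ-sym : (i j : Fin n) → δ i j ≡ δ j i
δ-sym zero    zero    = refl
δ-sym zero    (suc j) = refl
δ-sym (suc i) zero    = refl
δ-sym (suc i) (suc j) = δ-sym i j

sum-δ : ∀ n (f : Fin n → ℚ) (i : Fin n) → sumFin n (λ t → f t * δ i t) ≡ f i
sum-δ (suc n) f zero = begin
  f zero * 1ℚ + sumFin n (λ t → f (suc t) * 0ℚ)  ≡⟨ cong₂ _+_ (*-identityʳ (f zero))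
                                                     (trans (sum-cong n (λ t → *-zeroʳ (f (suc t))))
                                                            (sum-zero n)) ⟩
  f zero + 0ℚ                                   ≡⟨ +-identityʳ (f zero) ⟩
  f zero                                        ∎
  where open ≡-Reasoning
sum-δ (suc n) f (suc i) =
  trans (cong (_+ sumFin n (λ t → f (suc t) * δ i t)) (*-zeroʳ (f zero))) (trans (+-identityˡ (sumFin n (λ t → f (suc t) * δ i t))) (sum-δ n (λ t → f (suc t)) i))

sum-δ-col : ∀ n (j : Fin n) → sumFin n (λ i → δ i j) ≡ 1ℚ
sum-δ-col n j = trans (sum-cong n (λ i → trans (δ-sym i j) (sym (*-identityˡ (δ j i)))))
                      (sum-δ n (λ _ → 1ℚ) j)

dot-comm : (u v : Vecℚ n) → dot u v ≡ dot v u
dot-comm {n} u v = sum-cong n (λ i → *-comm (u i) (v i))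

dot-zero : (u : Vecℚ n) → dot u (λ _ → 0ℚ) ≡ 0ℚ
dot-zero {n} u = trans (sum-cong n (λ i → *-zeroʳ (u i))) (sum-zero n)

dot-sub : (u v w : Vecℚ n) → dot u (v -ᵥ w) ≡ dot u v - dot u w
dot-sub {n} u v w = begin
  sumFin n (λ i → u i * (v i - w i))         ≡⟨ sum-cong n (λ i → distrib (u i) (v i) (w i)) ⟩
  sumFin n (λ i → u i * v i + - (u i * w i)) ≡⟨ sum-+ n _ _ ⟩
  dot u v + sumFin n (λ i → - (u i * w i))   ≡⟨ cong (dot u v +_) (sym (sum-neg n _)) ⟩
  dot u v - dot u w                          ∎
  where
  open ≡-Reasoning
  distrib : ∀ a b c → a * (b - c) ≡ a * b + - (a * c)
  distrib = solve 3 (λ a b c → a :* (b :+ (:- c)) := a :* b :+ (:- (a :* c))) refl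

dot-negˡ : (u v : Vecℚ n) → dot (λ t → - u t) v ≡ - dot u v
dot-negˡ {n} u v = trans (sum-cong n (λ t → sym (neg-distribˡ-* (u t) (v t))))
                         (sym (sum-neg n _))

dot-sumˡ : ∀ m (V : Fin m → Vecℚ n) (w : Vecℚ n) →
  dot (λ t → sumFin m (λ r → V r t)) w ≡ sumFin m (λ r → dot (V r) w)
dot-sumˡ {n} m V w =
  trans (sum-cong n (λ t → sum-*ʳ m (w t) (λ r → V r t))) (sum-swap n m _)

indicator : ∀ {a} {X : Set a} → Dec X → ℚ
indicator (yes _) = 1ℚ
indicator (no _)  = 0ℚ

permuted : Permutation′ n → Permutation′ n → Matℚ n → Matℚ n
permuted σ τ D a b = D (σ ⟨$⟩ʳ a) (τ ⟨$⟩ʳ b)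

DS-permute : ∀ {D : Matℚ n} (σ τ : Permutation′ n) →
             DoublyStochastic D → DoublyStochastic (permuted σ τ D)
DS-permute {n} {D} σ τ (nonneg , rows , cols) =
    (λ a b → nonneg _ _)
  , (λ a → trans (sym (sum-permute n (D (σ ⟨$⟩ʳ a)) τ)) (rows _))
  , (λ b → trans (sym (sum-permute n (λ i → D i (τ ⟨$⟩ʳ b)) σ)) (cols _))

weighted-rows : ∀ {D : Matℚ n} → DoublyStochastic D → (w : Fin n → ℚ) →
  sumFin n (λ a → sumFin n (λ b → w a * D a b)) ≡ sumFin n (λ a → w a * 1ℚ)
weighted-rows {n} {D} (_ , rows , _) w =
  sum-cong n (λ a → trans (sym (sum-*ˡ n (w a) (D a))) (cong (w a *_) (rows a)))

weighted-cols : ∀ {D : Matℚ n} → DoublyStochastic D → (w : Fin n → ℚ) →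
  sumFin n (λ a → sumFin n (λ b → w b * D a b)) ≡ sumFin n (λ b → w b * 1ℚ)
weighted-cols {n} {D} (_ , _ , cols) w = trans (sum-swap n n _)
  (sum-cong n (λ b → trans (sym (sum-*ˡ n (w b) (λ a → D a b))) (cong (w b *_) (cols b))))

-- If a doubly stochastic matrix vanishes on the block (¬S) × S, it also
-- vanishes on S × (¬S): the mass of the rows in S equals that of the columns
-- in S, and it can only leave S through the block S × (¬S).
DS-block : ∀ {ℓ} {D : Matℚ n} → DoublyStochastic D →
  {S : Pred (Fin n) ℓ} (S? : Decidable S) →
  (∀ a b → ¬ S a → S b → D a b ≡ 0ℚ) →
  ∀ a b → S a → ¬ S b → D a b ≡ 0ℚ
DS-block {n = n} {D = D} ds@(nonneg , _) S? lower a b Sa ¬Sb =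
  ≤-antisym (≮⇒≥ mass-leaves) (nonneg a b)
  where
  -- D with each entry weighted by membership of its column (row) in S;
  -- both have total mass |S|, but byCol ≤ byRow entrywise.
  byCol byRow : Matℚ n
  byCol x y = indicator (S? y) * D x y
  byRow x y = indicator (S? x) * D x y

  byCol≤byRow : ∀ x y → byCol x y ≤ℚ byRow x y
  byCol≤byRow x y with S? x | S? y
  ... | yes _  | yes _  = ≤-refl
  ... | no _   | no _   = ≤-refl
  ... | yes _  | no _   = subst₂ _≤ℚ_ (sym (*-zeroˡ (D x y))) (sym (*-identityˡ (D x y)))
                                  (nonneg x y)
  ... | no ¬Sx | yes Sy = ≤-reflexive (begin
        1ℚ * D x y  ≡⟨ *-identityˡ (D x y) ⟩
        D x y       ≡⟨ lower x y ¬Sx Sy ⟩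
        0ℚ          ≡⟨ sym (*-zeroˡ (D x y)) ⟩
        0ℚ * D x y  ∎)
    where open ≡-Reasoning

  byCol<byRow : 0ℚ <ℚ D a b → byCol a b <ℚ byRow a b
  byCol<byRow pos with S? a | S? b
  ... | no ¬Sa | _      = contradiction Sa ¬Sa
  ... | _      | yes Sb = contradiction Sb ¬Sb
  ... | yes _  | no _   = subst₂ _<ℚ_ (sym (*-zeroˡ (D a b))) (sym (*-identityˡ (D a b))) pos

  mass-leaves : ¬ (0ℚ <ℚ D a b)
  mass-leaves pos = <-irrefl
    (trans (weighted-cols ds (λ x → indicator (S? x)))
           (sym (weighted-rows ds (λ x → indicator (S? x)))))
    (sum-mono-< n (λ x → sum-mono-≤ n (byCol≤byRow x)) a
                  (sum-mono-< n (byCol≤byRow a) b (byCol<byRow pos)))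

-- A vector whose values on the vertices are δₖ + c (an affine function
-- vanishing on the facet opposite vertex k, and larger by 1 at vertex k)
-- is an inward normal of that facet.
dual-normal : (A : Matℚ n) (k : Fin (suc n)) (u : Vecℚ n) (c : ℚ) →
  (∀ a → dot u (vertex A a) ≡ δ k a + c) → InwardNormal A k u
dual-normal A k u c values = on-facet , towards-k
  where
  cancel : ∀ x y → (x + c) - (y + c) ≡ x - y
  cancel x y = solve 3 (λ x y c → (x :+ c) :+ (:- (y :+ c)) := x :+ (:- y)) refl x y c

  edge : ∀ a b → dot u (vertex A a -ᵥ vertex A b) ≡ δ k a - δ k b
  edge a b = trans (dot-sub u _ _) (trans (cong₂ _-_ (values a) (values b)) (cancel (δ k a) (δ k b)))

  off : ∀ a → a ≢ k → δ k a ≡ 0ℚ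
  off a a≢k = δ-≢ k a (λ k≡a → a≢k (sym k≡a))

  on-facet : ∀ a b → a ≢ k → b ≢ k → dot u (vertex A a -ᵥ vertex A b) ≡ 0ℚ
  on-facet a b a≢k b≢k =
    trans (edge a b) (trans (cong₂ _-_ (off a a≢k) (off b b≢k)) (+-inverseʳ 0ℚ))

  towards-k : ∀ a → a ≢ k → 0ℚ <ℚ dot u (vertex A k -ᵥ vertex A a)
  towards-k a a≢k = subst (0ℚ <ℚ_)
    (sym (trans (edge k a) (cong₂ _-_ (δ-diag k) (off a a≢k)))) (positive⁻¹ 1ℚ)

module InverseNormals (A Q : Matℚ n)
  (QA : ∀ i j → sumFin n (λ k → Q i k * A k j) ≡ δ i j) where

  G : Matℚ n
  G j m = dot (Q j) (Q m)

  row-normal : ∀ k → InwardNormal A (suc k) (Q k)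
  row-normal k = dual-normal A (suc k) (Q k) 0ℚ values
    where
    values : ∀ a → dot (Q k) (vertex A a) ≡ δ (suc k) a + 0ℚ
    values zero    = dot-zero (Q k)
    values (suc j) = trans (QA k j) (sym (+-identityʳ _))

  u₀ : Vecℚ n
  u₀ t = - sumFin n (λ m → Q m t)

  u₀-normal : InwardNormal A zero u₀
  u₀-normal = dual-normal A zero u₀ (- 1ℚ) values
    where
    values : ∀ a → dot u₀ (vertex A a) ≡ δ zero a + - 1ℚ
    values zero    = dot-zero u₀
    values (suc j) = begin
      dot u₀ (col A j)                        ≡⟨ dot-negˡ (λ t → sumFin n (λ m → Q m t)) (col A j) ⟩
      - dot (λ t → sumFin n (λ m → Q m t)) (col A j)
                                              ≡⟨ cong -_ (dot-sumˡ n Q (col A j)) ⟩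
      - sumFin n (λ m → dot (Q m) (col A j))  ≡⟨ cong -_ (sum-cong n (λ m → QA m j)) ⟩
      - sumFin n (λ m → δ m j)                ≡⟨ cong -_ (sum-δ-col n j) ⟩
      - 1ℚ                                    ∎
      where open ≡-Reasoning

  G-offdiag-neg : AcuteSimplex A → ∀ j m → j ≢ m → G j m <ℚ 0ℚ
  G-offdiag-neg acute j m j≢m =
    acute (suc j) (suc m) (λ e → j≢m (suc-injective e))
          (Q j) (Q m) (row-normal j) (row-normal m)

  G-rowsum-pos : AcuteSimplex A → ∀ j → 0ℚ <ℚ sumFin n (G j)
  G-rowsum-pos acute j =
    subst (0ℚ <ℚ_) (solve 1 (λ s → :- (:- s) := s) refl _) (neg-antimono-< −rowsum<0)
    where
    open ≡-Reasoning
    normals-meet : dot (Q j) u₀ ≡ - sumFin n (G j)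
    normals-meet = begin
      dot (Q j) u₀                          ≡⟨ dot-comm (Q j) u₀ ⟩
      dot u₀ (Q j)                          ≡⟨ dot-negˡ (λ t → sumFin n (λ m → Q m t)) (Q j) ⟩
      - dot (λ t → sumFin n (λ m → Q m t)) (Q j)
                                            ≡⟨ cong -_ (dot-sumˡ n Q (Q j)) ⟩
      - sumFin n (λ m → dot (Q m) (Q j))    ≡⟨ cong -_ (sum-cong n (λ m → dot-comm (Q m) (Q j))) ⟩
      - sumFin n (G j)                      ∎

    −rowsum<0 : - sumFin n (G j) <ℚ 0ℚ
    −rowsum<0 = subst (_<ℚ 0ℚ) normals-meet (acute (suc j) zero (λ ()) (Q j) u₀ (row-normal j) u₀-normal)

  -- Qᵀ = G Aᵀ, because G Aᵀ = Q (A Q)ᵀ = Q.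
  Q-via-G : (∀ i j → sumFin n (λ k → A i k * Q k j) ≡ δ i j) →
            ∀ j i → Q j i ≡ sumFin n (λ m → G j m * A i m)
  Q-via-G AQ j i = sym (begin
    sumFin n (λ m → sumFin n (λ t → Q j t * Q m t) * A i m)
      ≡⟨ sum-cong n (λ m → trans (sum-*ʳ n (A i m) _) (sum-cong n (λ t → reorder (Q j t) (Q m t) (A i m)))) ⟩
    sumFin n (λ m → sumFin n (λ t → Q j t * (A i m * Q m t)))
      ≡⟨ sum-swap n n _ ⟩
    sumFin n (λ t → sumFin n (λ m → Q j t * (A i m * Q m t)))
      ≡⟨ sum-cong n (λ t → trans (sym (sum-*ˡ n (Q j t) _)) (cong (Q j t *_) (AQ i t))) ⟩
    sumFin n (λ t → Q j t * δ i t)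
      ≡⟨ sum-δ n (Q j) i ⟩
    Q j i ∎)
    where
    open ≡-Reasoning
    reorder : ∀ a b c → (a * b) * c ≡ a * (c * b)
    reorder = solve 3 (λ a b c → (a :* b) :* c := a :* (c :* b)) refl

module ZeroOnePattern (P : Mat01 n) (Q : Matℚ n)
  (QA : ∀ i j → sumFin n (λ k → Q i k * toℚMat P k j) ≡ δ i j)
  (AQ : ∀ i j → sumFin n (λ k → toℚMat P i k * Q k j) ≡ δ i j)
  (acute : AcuteSimplex (toℚMat P)) where

  open InverseNormals (toℚMat P) Q QA

  columns-differ : ∀ {i j m} → P i j ≡ true → P i m ≡ false → G j m <ℚ 0ℚ
  columns-differ {i} {j} {m} Pij Pim = G-offdiag-neg acute j m j≢m
    where
    j≢m : j ≢ m
    j≢m refl = contradiction (trans (sym Pij) Pim) (λ ())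

  columns-differ′ : ∀ {i j m} → P i j ≡ false → P i m ≡ true → G j m <ℚ 0ℚ
  columns-differ′ {j = j} {m} Pij Pim = subst (_<ℚ 0ℚ) (dot-comm (Q m) (Q j)) (columns-differ Pim Pij)

  Q-pos : ∀ {i j} → P i j ≡ true → 0ℚ <ℚ Q j i
  Q-pos {i} {j} Pij = <-≤-trans (G-rowsum-pos acute j)
    (subst (sumFin n (G j) ≤ℚ_) (sym (Q-via-G AQ j i)) (sum-mono-≤ n G≤term))
    where
    G≤term : ∀ m → G j m ≤ℚ G j m * toℚMat P i m
    G≤term m with P i m in Pim
    ... | true  = ≤-reflexive (sym (*-identityʳ (G j m)))
    ... | false = ≤-trans (<⇒≤ (columns-differ Pij Pim)) (≤-reflexive (sym (*-zeroʳ (G j m))))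

  Q-neg : ∀ {i j l} → P i j ≡ false → P i l ≡ true → Q j i <ℚ 0ℚ
  Q-neg {i} {j} {l} Pij Pil =
    subst (_<ℚ 0ℚ) (sym (Q-via-G AQ j i)) (sum-<0 n term≤0 l term<0)
    where
    term≤0 : ∀ m → G j m * toℚMat P i m ≤ℚ 0ℚ
    term≤0 m with P i m in Pim
    ... | true  = subst (_≤ℚ 0ℚ) (sym (*-identityʳ (G j m))) (<⇒≤ (columns-differ′ Pij Pim))
    ... | false = ≤-reflexive (*-zeroʳ (G j m))

    term<0 : G j l * toℚMat P i l <ℚ 0ℚ
    term<0 = subst (_<ℚ 0ℚ) (sym (trans (cong (λ b → G j l * b2q b) Pil) (*-identityʳ (G j l))))
                   (columns-differ′ Pij Pil)

  E : Matℚ n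
  E i j = toℚMat P i j * Q j i

  E-pos : ∀ {i j} → P i j ≡ true → 0ℚ <ℚ E i j
  E-pos {i} {j} Pij =
    subst (0ℚ <ℚ_) (sym (trans (cong (λ b → b2q b * Q j i) Pij) (*-identityˡ (Q j i)))) (Q-pos Pij)

  E-zero : ∀ {i j} → P i j ≡ false → E i j ≡ 0ℚ
  E-zero {i} {j} Pij = trans (cong (λ b → b2q b * Q j i) Pij) (*-zeroˡ (Q j i))

  E-zero⇒P-false : ∀ {i j} → E i j ≡ 0ℚ → P i j ≡ false
  E-zero⇒P-false Eij≡0 = ¬-not (λ Pij → <⇒≢ (E-pos Pij) (sym Eij≡0))

  -- Rows and columns of E sum to the diagonal entries of P Q and Q P.
  E-DS : DoublyStochastic E
  E-DS = nonneg
       , (λ i → trans (AQ i i) (δ-diag i))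
       , (λ j → trans (sum-cong n (λ i → *-comm (toℚMat P i j) (Q j i))) (trans (QA j j) (δ-diag j)))
    where
    nonneg : ∀ i j → 0ℚ ≤ℚ E i j
    nonneg i j with P i j in Pij
    ... | true  = subst (0ℚ ≤ℚ_) (sym (*-identityˡ (Q j i))) (<⇒≤ (Q-pos Pij))
    ... | false = ≤-reflexive (sym (*-zeroˡ (Q j i)))

  E-support : supp-eq E P
  E-support i j = mk⇔ nonzero⇒one one⇒nonzero
    where
    nonzero⇒one : E i j ≢ 0ℚ → P i j ≡ true
    nonzero⇒one Eij≢0 with P i j in Pij
    ... | true  = refl
    ... | false = contradiction (*-zeroˡ (Q j i)) Eij≢0

    one⇒nonzero : P i j ≡ true → E i j ≢ 0ℚ
    one⇒nonzero Pij Eij≡0 = <⇒≢ (E-pos Pij) (sym Eij≡0)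

  -- Every column of P is nonzero, and no column avoids the support of another:
  -- otherwise (Q P) j l = Σᵢ Q j i · P i l would be a negative sum.
  column-nonzero : ∀ l → ¬ (∀ i → P i l ≡ false)
  column-nonzero l empty = <⇒≢ (positive⁻¹ 1ℚ) (sym (begin
    1ℚ                                         ≡⟨ sym (δ-diag l) ⟩
    δ l l                                      ≡⟨ sym (QA l l) ⟩
    sumFin n (λ i → Q l i * toℚMat P i l)      ≡⟨ sum-cong n (λ i → trans (cong (λ b → Q l i * b2q b) (empty i)) (*-zeroʳ (Q l i))) ⟩
    sumFin n (λ _ → 0ℚ)                        ≡⟨ sum-zero n ⟩
    0ℚ                                         ∎))
    where open ≡-Reasoning

  columns-share-row : ∀ j l → j ≢ l → ¬ (∀ i → P i j ≡ true → P i l ≡ false)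
  columns-share-row j l j≢l disjoint = column-nonzero l column-l-empty
    where
    not-in-j : ∀ {i} → P i l ≡ true → P i j ≡ false
    not-in-j {i} Pil with P i j in Pij
    ... | true  = contradiction (trans (sym Pil) (disjoint i Pij)) (λ ())
    ... | false = refl

    term<0 : ∀ {i} → P i l ≡ true → Q j i * toℚMat P i l <ℚ 0ℚ
    term<0 {i} Pil = subst (_<ℚ 0ℚ) (sym (trans (cong (λ b → Q j i * b2q b) Pil) (*-identityʳ (Q j i))))
                           (Q-neg (not-in-j Pil) Pil)

    term≤0 : ∀ i → Q j i * toℚMat P i l ≤ℚ 0ℚ
    term≤0 i with P i l in Pil
    ... | true  = subst (_≤ℚ 0ℚ) (sym (*-identityʳ (Q j i))) (<⇒≤ (Q-neg (not-in-j Pil) Pil))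
    ... | false = ≤-reflexive (*-zeroʳ (Q j i))

    column-l-empty : ∀ i → P i l ≡ false
    column-l-empty i with P i l in Pil
    ... | true  = contradiction (trans (QA j l) (δ-≢ j l j≢l)) (<⇒≢ (sum-<0 n term≤0 i (term<0 Pil)))
    ... | false = refl

  doubly-stochastic-pattern : HasDoublyStochasticPattern P
  doubly-stochastic-pattern = E , E-DS , E-support

  -- A zero block of P in permuted coordinates is a zero block of the doubly
  -- stochastic matrix E, so the complementary block vanishes as well; then
  -- the first column of the left block and the first column of the right
  -- block have disjoint supports.
  fully-indecomposable : FullyIndecomposable P
  fully-indecomposable (k , 1≤k , k≤n∸1 , σ , τ , lower-zero) =
    columns-share-row j l j≢l disjoint
    where
    k<n : k < n
    k<n = below-pred n 1≤k k≤n∸1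

    upper-zero : ∀ a b → toℕ a < k → ¬ toℕ b < k → P (σ ⟨$⟩ʳ a) (τ ⟨$⟩ʳ b) ≡ false
    upper-zero = λ a b a<k b≮k → E-zero⇒P-false
      (DS-block (DS-permute σ τ E-DS) (λ x → toℕ x <? k)
                (λ x y x≮k y<k → E-zero (lower-zero x y (NP.≮⇒≥ x≮k) y<k))
                a b a<k b≮k)

    b₀ b₁ : Fin n
    b₀ = fromℕ< (NP.<-trans 1≤k k<n)
    b₁ = fromℕ< k<n

    b₀<k : toℕ b₀ < k
    b₀<k = subst (_< k) (sym (toℕ-fromℕ< (NP.<-trans 1≤k k<n))) 1≤k

    b₁≮k : ¬ toℕ b₁ < k
    b₁≮k = NP.<-irrefl (toℕ-fromℕ< k<n)

    j l : Fin n
    j = τ ⟨$⟩ʳ b₀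
    l = τ ⟨$⟩ʳ b₁

    j≢l : j ≢ l
    j≢l j≡l = b₁≮k (subst (λ b → toℕ b < k) b₀≡b₁ b₀<k)
      where
      b₀≡b₁ : b₀ ≡ b₁
      b₀≡b₁ = trans (sym (inverseˡ τ)) (trans (cong (τ ⟨$⟩ˡ_) j≡l) (inverseˡ τ))

    disjoint : ∀ i → P i j ≡ true → P i l ≡ false
    disjoint i Pij with toℕ (σ ⟨$⟩ˡ i) <? k
    ... | yes a<k = subst (λ x → P x l ≡ false) (inverseʳ σ) (upper-zero _ b₁ a<k b₁≮k)
    ... | no a≮k  = contradiction
      (trans (sym (subst (λ x → P x j ≡ true) (sym (inverseʳ σ)) Pij))
             (lower-zero _ b₀ (NP.≮⇒≥ a≮k) b₀<k))
      (λ ())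

corollary3p3 : (n : ℕ) → 1 ≤ n → (P : Mat01 n) →
    Nonsingular (toℚMat P) → AcuteSimplex (toℚMat P) →
    FullyIndecomposable P × HasDoublyStochasticPattern P
corollary3p3 n _ P (Q , QA , AQ) acute =
  fully-indecomposable , doubly-stochastic-pattern
  where open ZeroOnePattern P Q QA AQ acute
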